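{- Let $D$ be a digraph such that $\mathsf{d}_s^-(D)\ge 2$ and $D-a$ is strong for every $a\in A(D)$. The following are equivalent: (a) $D$ is a strong in-domatic critical digraph; (b) every strong in-domatic partition $\mathfrak{S}=\{S_1,\dots,S_k\}$ of $V(D)$ with $k=\mathsf{d}_s^-(D)$ satisfies (b.1) $D\langle S_i\rangle-a$ is not strong for every $i\in\{1,\dots,k\}$ and every arc $a$ of $D\langle S_i\rangle$, and (b.2) $|S_i\cap N^+(u)|=1$ for every $i\in\{1,\dots,k\}$ and every $u\in V(D)\setminus S_i$.
   Context: Digraphs are finite, loopless, without parallel arcs. A digraph is strong if for every ordered pair $u,v$ there is a directed $uv$-walk. $N^+(u)$ is the set of out-neighbors of $u$. $S\subseteq V(D)$ is in-dominating if every vertex not in $S$ has an out-neighbor in $S$; strong in-dominating if moreover the induced subdigraph $D\langle S\rangle$ is strong. A strong in-domatic partition is a partition of $V(D)$ into strong in-dominating sets; $\mathsf{d}_s^-(D)$ is the maximum number of its classes. $D$ is a strong in-domatic critical digraph if for every arc $a$ of $D$, $D-a$ is strong and $\mathsf{d}_s^-(D-a)=\mathsf{d}_s^-(D)-1$. -}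

module Defs where

open import Data.Nat using (ℕ; _≤_; _∸_)
open import Data.Bool using (Bool; true; false; _∧_; not)
open import Data.Fin using (Fin; _≟_)
open import Data.Fin.Subset using (Subset; _∈_; _∉_; ⊤; _∩_; ∣_∣)
open import Data.Vec using (tabulate)
open import Data.Product using (Σ; ∃; _×_; _,_)
open import Relation.Binary.PropositionalEquality using (_≡_; _≢_)
open import Relation.Nullary using (¬_; does)
open import Function.Definitions using (Surjective)
open import Function.Bundles using (_⇔_)

record Digraph : Set where
  field
    n        : ℕ
    arc      : Fin n → Fin n → Bool
    loopless : ∀ v → arc v v ≡ false
open Digraph public

Arc : (D : Digraph) → Fin (n D) → Fin (n D) → Set
Arc D u v = arc D u v ≡ true

_-arc_ : (D : Digraph) → Fin (n D) × Fin (n D) → Digraph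
D -arc (x , y) = record
  { n = n D
  ; arc = λ u v → arc D u v ∧ not (does (u ≟ x) ∧ does (v ≟ y))
  ; loopless = λ v → lem v }
  where
  open import Relation.Binary.PropositionalEquality using (refl)
  lem : ∀ v → (arc D v v ∧ not (does (v ≟ x) ∧ does (v ≟ y))) ≡ false
  lem v with arc D v v | loopless D v
  ... | false | refl = refl

data Walk (D : Digraph) (S : Subset (n D)) : Fin (n D) → Fin (n D) → Set where
  [] : ∀ {u} → Walk D S u u
  _∷_ : ∀ {u w v} → (Arc D u w × w ∈ S) → Walk D S w v → Walk D S u v

StrongOn : (D : Digraph) → Subset (n D) → Set
StrongOn D S = ∀ u v → u ∈ S → v ∈ S → Walk D S u v

Strong : Digraph → Set
Strong D = StrongOn D ⊤

InDominating : (D : Digraph) → Subset (n D) → Set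
InDominating D S = ∀ v → v ∉ S → ∃ λ w → w ∈ S × Arc D v w

StrongInDominating : (D : Digraph) → Subset (n D) → Set
StrongInDominating D S = InDominating D S × StrongOn D S

Class : ∀ {m k} → (Fin m → Fin k) → Fin k → Subset m
Class f i = tabulate (λ v → does (f v ≟ i))

OutNbr : (D : Digraph) → Fin (n D) → Subset (n D)
OutNbr D u = tabulate (λ v → arc D u v)

-- a strong in-domatic partition into exactly k (nonempty) classes,
-- encoded as a surjective class labelling
IsSIDP : (D : Digraph) (k : ℕ) → (Fin (n D) → Fin k) → Set
IsSIDP D k f = Surjective _≡_ _≡_ f × (∀ i → StrongInDominating D (Class f i))

HasSIDP : Digraph → ℕ → Set
HasSIDP D k = Σ (Fin (n D) → Fin k) (IsSIDP D k)

IsStrongInDomNum : Digraph → ℕ → Set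
IsStrongInDomNum D m = HasSIDP D m × (∀ k → HasSIDP D k → k ≤ m)

StrongInDomCritical : Digraph → Set
StrongInDomCritical D =
  ∀ u v → Arc D u v →
    Strong (D -arc (u , v)) ×
    ∃ λ m → IsStrongInDomNum D m × IsStrongInDomNum (D -arc (u , v)) (m ∸ 1)

ConditionB : (D : Digraph) → ℕ → Set
ConditionB D k =
  ∀ (f : Fin (n D) → Fin k) → IsSIDP D k f →
    (∀ i u v → u ∈ Class f i → v ∈ Class f i → Arc D u v →
       ¬ StrongOn (D -arc (u , v)) (Class f i))
    × (∀ i u → u ∉ Class f i → ∣ Class f i ∩ OutNbr D u ∣ ≡ 1)

-- Deleting an arc uv from D can only spoil the class of v in a strong in-domatic
-- partition: every other class keeps its domination arcs and its induced subdigraph.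
-- Since D - uv is strong, some u ⇝ v walk of D - uv last leaves the class of v from
-- a class q, and merging these two classes gives a partition of D - uv with one class
-- fewer; hence d_s^-(D - a) = d_s^-(D) - 1 exactly when no maximum partition of D
-- survives the deletion of a. A maximum partition survives deleting an arc inside a
-- class iff that class stays strong (b.1), and deleting an arc uv between classes iff
-- u has a second out-neighbour in the class of v (b.2).
module Submission where

open import Defs
open import Data.Nat using (ℕ; _≤_)
open import Data.Product using (_×_; _,_)
open import Function.Bundles using (_⇔_)

open import Data.Nat using (suc; _<_; _∸_; s≤s; z≤n) renaming (_≟_ to _≟ℕ_)
open import Data.Nat.Properties using (≤-antisym; ≤∧≢⇒<; ≤-pred; <-irrefl; 1+n≰n)
open import Data.Bool using (true; false)
open import Data.Fin using (Fin; _≟_; punchIn; punchOut) renaming (zero to fzero)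
open import Data.Fin.Properties using (punchOut-cong; punchIn-punchOut; punchOut-punchIn; punchInᵢ≢i)
open import Data.Fin.Subset using (Subset; _∈_; _∉_; ⊤; _∪_; _∩_; ∣_∣; ⁅_⁆; _⊆_; _⊂_)
open import Data.Fin.Subset.Properties
  using (_∈?_; ∈⊤; x∈⁅x⁆; x∈⁅y⁆⇒x≡y; x≢y⇒x∉⁅y⁆; ∣⁅x⁆∣≡1; ⊆-antisym; p⊂q⇒∣p∣<∣q∣;
         p⊆p∪q; q⊆p∪q; x∈p∪q⁺; x∈p∪q⁻; x∈p∩q⁺; x∈p∩q⁻)
open import Data.Vec.Properties using (lookup∘tabulate; []=⇒lookup; lookup⇒[]=)
open import Data.Product using (∃; proj₁; proj₂; map₁; map₂)
open import Data.Sum using (_⊎_; inj₁; inj₂; [_,_]′)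
open import Function using (_∘_)
open import Function.Definitions using (Surjective)
open import Function.Bundles using (mk⇔)
open import Relation.Nullary using (¬_; yes; no; contradiction)
open import Relation.Nullary.Decidable using (dec-true; _×-dec_)
open import Relation.Binary.PropositionalEquality using (_≡_; _≢_; refl; sym; trans; cong; subst; subst₂)

∈-Class⁻ : ∀ {m k} (f : Fin m → Fin k) {i z} → z ∈ Class f i → f z ≡ i
∈-Class⁻ f {i} {z} z∈ with f z ≟ i | trans (sym (lookup∘tabulate _ z)) ([]=⇒lookup z∈)
... | yes fz≡i | _ = fz≡i
... | no _     | ()

∈-Class⁺ : ∀ {m k} (f : Fin m → Fin k) {i z} → f z ≡ i → z ∈ Class f i
∈-Class⁺ f {i} {z} fz≡i =
  lookup⇒[]= z _ (trans (lookup∘tabulate _ z) (dec-true (f z ≟ i) fz≡i))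

∈-OutNbr⁻ : ∀ (D : Digraph) {u z} → z ∈ OutNbr D u → Arc D u z
∈-OutNbr⁻ D {u} {z} z∈ = trans (sym (lookup∘tabulate (arc D u) z)) ([]=⇒lookup z∈)

∈-OutNbr⁺ : ∀ (D : Digraph) {u z} → Arc D u z → z ∈ OutNbr D u
∈-OutNbr⁺ D {u} {z} u⇒z = lookup⇒[]= z _ (trans (lookup∘tabulate (arc D u) z) u⇒z)

∣p∣≡1⁺ : ∀ {m} {p : Subset m} {x} → x ∈ p → (∀ {y} → y ∈ p → y ≡ x) → ∣ p ∣ ≡ 1
∣p∣≡1⁺ {p = p} {x} x∈p only = trans (cong ∣_∣ (⊆-antisym p⊆⁅x⁆ ⁅x⁆⊆p)) (∣⁅x⁆∣≡1 x)
  where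
  p⊆⁅x⁆ : p ⊆ ⁅ x ⁆
  p⊆⁅x⁆ y∈p = subst (_∈ ⁅ x ⁆) (sym (only y∈p)) (x∈⁅x⁆ x)
  ⁅x⁆⊆p : ⁅ x ⁆ ⊆ p
  ⁅x⁆⊆p y∈⁅x⁆ = subst (_∈ p) (sym (x∈⁅y⁆⇒x≡y x y∈⁅x⁆)) x∈p

∣p∣≡1⁻ : ∀ {m} {p : Subset m} {x y} → ∣ p ∣ ≡ 1 → x ∈ p → y ∈ p → x ≡ y
∣p∣≡1⁻ {p = p} {x} {y} ∣p∣≡1 x∈p y∈p with x ≟ y
... | yes x≡y = x≡y
... | no x≢y  = contradiction (subst₂ _<_ (∣⁅x⁆∣≡1 y) ∣p∣≡1 (p⊂q⇒∣p∣<∣q∣ ⁅y⁆⊂p)) (<-irrefl refl)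
  where
  ⁅y⁆⊂p : ⁅ y ⁆ ⊂ p
  ⁅y⁆⊂p = (λ z∈⁅y⁆ → subst (_∈ p) (sym (x∈⁅y⁆⇒x≡y y z∈⁅y⁆)) y∈p) , x , x∈p , x≢y⇒x∉⁅y⁆ x≢y

_++ʷ_ : ∀ {G S x y z} → Walk G S x y → Walk G S y z → Walk G S x z
[] ++ʷ walk = walk
(step ∷ walk₁) ++ʷ walk₂ = step ∷ (walk₁ ++ʷ walk₂)

Walk-mono : ∀ {G} {S T : Subset (n G)} {x y} → S ⊆ T → Walk G S x y → Walk G T x y
Walk-mono S⊆T [] = []
Walk-mono S⊆T ((x⇒w , w∈S) ∷ walk) = (x⇒w , S⊆T w∈S) ∷ Walk-mono S⊆T walk

Walk-lastExit : ∀ {G} (S : Subset (n G)) {x y} → Walk G ⊤ x y →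
  Walk G S x y ⊎ ∃ λ z → z ∉ S × Walk G S z y
Walk-lastExit S [] = inj₁ []
Walk-lastExit S (_∷_ {w = w} (x⇒w , _) walk) with Walk-lastExit S walk
... | inj₂ exit = inj₂ exit
... | inj₁ w⇝y with w ∈? S
...   | yes w∈S = inj₁ ((x⇒w , w∈S) ∷ w⇝y)
...   | no w∉S  = inj₂ (w , w∉S , w⇝y)

-- y is arbitrary: the start of a walk need not lie in the set it is confined to.
Walk-into : ∀ {G} {S T : Subset (n G)} {x} → StrongInDominating G S → S ⊆ T → x ∈ S →
  ∀ y → Walk G T y x
Walk-into {S = S} {x = x} (dom , str) S⊆T x∈S y with y ∈? S
... | yes y∈S = Walk-mono S⊆T (str y x y∈S x∈S)
... | no y∉S with dom y y∉S
...   | w , w∈S , y⇒w = (y⇒w , S⊆T w∈S) ∷ Walk-mono S⊆T (str w x w∈S x∈S)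

StrongOn-∪ : ∀ {G} {S T : Subset (n G)} →
  StrongInDominating G S → StrongInDominating G T → StrongOn G (S ∪ T)
StrongOn-∪ {S = S} {T} sidS sidT y x _ x∈S∪T with x∈p∪q⁻ S T x∈S∪T
... | inj₁ x∈S = Walk-into sidS (p⊆p∪q T) x∈S y
... | inj₂ x∈T = Walk-into sidT (q⊆p∪q S T) x∈T y

InDominating-mono : ∀ {G} {S T : Subset (n G)} → S ⊆ T → InDominating G S → InDominating G T
InDominating-mono S⊆T dom z z∉T = map₂ (map₁ (λ w∈S → S⊆T w∈S)) (dom z (z∉T ∘ S⊆T))

module DeleteArc (D : Digraph) (u v : Fin (n D)) where

  E : Digraph
  E = D -arc (u , v)

  arc⁻ : ∀ {x y} → Arc E x y → Arc D x y
  arc⁻ {x} {y} x⇒y with arc D x y | x⇒y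
  ... | true  | _ = refl
  ... | false | ()

  arc⁺ : ∀ {x y} → Arc D x y → ¬ (x ≡ u × y ≡ v) → Arc E x y
  arc⁺ {x} {y} x⇒y ¬uv with arc D x y | x⇒y | x ≟ u | y ≟ v
  ... | true | _ | yes refl | yes refl = contradiction (refl , refl) ¬uv
  ... | true | _ | yes _    | no _     = refl
  ... | true | _ | no _     | _        = refl

  ¬arc-deleted : ¬ Arc E u v
  ¬arc-deleted u⇒v with arc D u v | u ≟ u | v ≟ v | u⇒v
  ... | false | _        | _        | ()
  ... | true  | yes _    | yes _    | ()
  ... | true  | no u≢u   | _        | _ = u≢u refl
  ... | true  | yes _    | no v≢v   | _ = v≢v refl

  Walk-deleteArc⁻ : ∀ {S x y} → Walk E S x y → Walk D S x y
  Walk-deleteArc⁻ [] = []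
  Walk-deleteArc⁻ ((x⇒w , w∈S) ∷ walk) = (arc⁻ x⇒w , w∈S) ∷ Walk-deleteArc⁻ walk

  Walk-deleteArc⁺ : ∀ {S x y} → (u ∈ S → v ∈ S → Walk E S u v) →
    x ∈ S → Walk D S x y → Walk E S x y
  Walk-deleteArc⁺ bypass x∈S [] = []
  Walk-deleteArc⁺ {x = x} bypass x∈S (_∷_ {w = w} (x⇒w , w∈S) walk) with (x ≟ u) ×-dec (w ≟ v)
  ... | yes (refl , refl) = bypass x∈S w∈S ++ʷ Walk-deleteArc⁺ bypass w∈S walk
  ... | no ¬uv            = (arc⁺ x⇒w ¬uv , w∈S) ∷ Walk-deleteArc⁺ bypass w∈S walk

  StrongOn-deleteArc : ∀ {S} → (u ∈ S → v ∈ S → Walk E S u v) → StrongOn D S → StrongOn E S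
  StrongOn-deleteArc bypass str x y x∈S y∈S = Walk-deleteArc⁺ bypass x∈S (str x y x∈S y∈S)

  StrongInDominating-deleteArc⁻ : ∀ {S} → StrongInDominating E S → StrongInDominating D S
  StrongInDominating-deleteArc⁻ (dom , str) =
    (λ z z∉S → map₂ (map₂ arc⁻) (dom z z∉S)) ,
    (λ x y x∈S y∈S → Walk-deleteArc⁻ (str x y x∈S y∈S))

  StrongInDominating-deleteArc⁺ : ∀ {S} → v ∉ S → StrongInDominating D S → StrongInDominating E S
  StrongInDominating-deleteArc⁺ {S} v∉S (dom , str) =
    domE , StrongOn-deleteArc (λ _ v∈S → contradiction v∈S v∉S) str
    where
    domE : InDominating E S
    domE z z∉S with dom z z∉S
    ... | w , w∈S , z⇒w = w , w∈S , arc⁺ z⇒w (λ { (_ , refl) → v∉S w∈S })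

  IsSIDP-deleteArc⁻ : ∀ {k f} → IsSIDP E k f → IsSIDP D k f
  IsSIDP-deleteArc⁻ (surj , sid) = surj , StrongInDominating-deleteArc⁻ ∘ sid

  IsSIDP-deleteArc⁺ : ∀ {k} {f : Fin (n D) → Fin k} → IsSIDP D k f →
    (f u ≡ f v → StrongOn E (Class f (f v))) →
    (f u ≢ f v → ∃ λ w → w ∈ Class f (f v) × Arc E u w) →
    IsSIDP E k f
  IsSIDP-deleteArc⁺ {f = f} (surj , sid) sameClass otherClass = surj , λ i → dom i , str i
    where
    dom : ∀ i → InDominating E (Class f i)
    dom i z z∉ with proj₁ (sid i) z z∉
    ... | w , w∈ , z⇒w with (z ≟ u) ×-dec (w ≟ v)
    ...   | no ¬uv = w , w∈ , arc⁺ z⇒w ¬uv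
    ...   | yes (refl , refl) with ∈-Class⁻ f w∈
    ...     | refl = otherClass (z∉ ∘ ∈-Class⁺ f)
    str : ∀ i → StrongOn E (Class f i)
    str i = StrongOn-deleteArc bypass (proj₂ (sid i))
      where
      bypass : u ∈ Class f i → v ∈ Class f i → Walk E (Class f i) u v
      bypass u∈ v∈ with ∈-Class⁻ f v∈
      ... | refl = sameClass (∈-Class⁻ f u∈) u v u∈ v∈

collapse : ∀ {k} {p q : Fin (suc k)} → p ≢ q → Fin (suc k) → Fin k
collapse {q = q} p≢q i with i ≟ q
... | yes _   = punchOut (p≢q ∘ sym)
... | no i≢q  = punchOut (i≢q ∘ sym)

module _ {k} {p q : Fin (suc k)} (p≢q : p ≢ q) where

  collapse-≢ : ∀ {i} (i≢q : i ≢ q) → collapse p≢q i ≡ punchOut (i≢q ∘ sym)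
  collapse-≢ {i} i≢q with i ≟ q
  ... | yes i≡q = contradiction i≡q i≢q
  ... | no _    = punchOut-cong q refl

  collapse-q : collapse p≢q q ≡ collapse p≢q p
  collapse-q with q ≟ q
  ... | yes _   = sym (collapse-≢ p≢q)
  ... | no q≢q  = contradiction refl q≢q

  collapse-punchIn : ∀ t → collapse p≢q (punchIn q t) ≡ t
  collapse-punchIn t = trans (collapse-≢ (punchInᵢ≢i q t)) (punchOut-punchIn q)

  collapse⁻ : ∀ {i t} → collapse p≢q i ≡ t → i ≡ punchIn q t ⊎ i ≡ q
  collapse⁻ {i} {t} ci≡t with i ≟ q
  ... | yes i≡q = inj₂ i≡q
  ... | no i≢q  = inj₁ (trans (sym (punchIn-punchOut (i≢q ∘ sym))) (cong (punchIn q) ci≡t))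

  punchIn-collapse : punchIn q (collapse p≢q p) ≡ p
  punchIn-collapse with collapse⁻ {p} refl
  ... | inj₁ p≡ = sym p≡
  ... | inj₂ p≡q = contradiction p≡q p≢q

  module _ {m} (f : Fin m → Fin (suc k)) where

    Class-collapse-merged : Class (collapse p≢q ∘ f) (collapse p≢q p) ≡ Class f p ∪ Class f q
    Class-collapse-merged = ⊆-antisym merged⊆ ⊆merged
      where
      merged⊆ : Class (collapse p≢q ∘ f) (collapse p≢q p) ⊆ Class f p ∪ Class f q
      merged⊆ z∈ with collapse⁻ (∈-Class⁻ (collapse p≢q ∘ f) z∈)
      ... | inj₁ fz≡ = x∈p∪q⁺ (inj₁ (∈-Class⁺ f (trans fz≡ punchIn-collapse)))
      ... | inj₂ fz≡q = x∈p∪q⁺ (inj₂ (∈-Class⁺ f fz≡q))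
      ⊆merged : Class f p ∪ Class f q ⊆ Class (collapse p≢q ∘ f) (collapse p≢q p)
      ⊆merged z∈ = [ (λ z∈p → ∈-Class⁺ (collapse p≢q ∘ f) (cong (collapse p≢q) (∈-Class⁻ f z∈p)))
                   , (λ z∈q → ∈-Class⁺ (collapse p≢q ∘ f)
                                (trans (cong (collapse p≢q) (∈-Class⁻ f z∈q)) collapse-q))
                   ]′ (x∈p∪q⁻ _ _ z∈)

    Class-collapse : ∀ {t} → t ≢ collapse p≢q p → Class (collapse p≢q ∘ f) t ≡ Class f (punchIn q t)
    Class-collapse {t} t≢ = ⊆-antisym collapsed⊆ ⊆collapsed
      where
      collapsed⊆ : Class (collapse p≢q ∘ f) t ⊆ Class f (punchIn q t)
      collapsed⊆ z∈ with collapse⁻ (∈-Class⁻ (collapse p≢q ∘ f) z∈)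
      ... | inj₁ fz≡ = ∈-Class⁺ f fz≡
      ... | inj₂ refl = contradiction (trans (sym (∈-Class⁻ (collapse p≢q ∘ f) z∈)) collapse-q) t≢
      ⊆collapsed : Class f (punchIn q t) ⊆ Class (collapse p≢q ∘ f) t
      ⊆collapsed z∈ = ∈-Class⁺ (collapse p≢q ∘ f)
                        (trans (cong (collapse p≢q) (∈-Class⁻ f z∈)) (collapse-punchIn t))

mergeClasses : ∀ {G k} {f : Fin (n G) → Fin (suc (suc k))} {p q} → p ≢ q →
  Surjective _≡_ _≡_ f → (∀ j → j ≢ p → StrongInDominating G (Class f j)) →
  StrongOn G (Class f p ∪ Class f q) → HasSIDP G (suc k)
mergeClasses {G} {f = f} {p} {q} p≢q surj sid str∪ = collapse p≢q ∘ f , surj′ , sid′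
  where
  surj′ : Surjective _≡_ _≡_ (collapse p≢q ∘ f)
  surj′ t with surj (punchIn q t)
  ... | z , fz≡ = z , λ { refl → trans (cong (collapse p≢q) (fz≡ refl)) (collapse-punchIn p≢q t) }
  sid′ : ∀ t → StrongInDominating G (Class (collapse p≢q ∘ f) t)
  sid′ t with t ≟ collapse p≢q p
  ... | yes refl = subst (StrongInDominating G) (sym (Class-collapse-merged p≢q f))
                     ( InDominating-mono {G} (q⊆p∪q (Class f p) (Class f q)) (proj₁ (sid q (p≢q ∘ sym)))
                     , str∪)
  ... | no t≢    = subst (StrongInDominating G) (sym (Class-collapse p≢q f t≢))
                     (sid (punchIn q t) (λ e → t≢ (trans (sym (collapse-punchIn p≢q t))
                                                          (cong (collapse p≢q) e))))

IsSIDP⇒HasSIDP-deleteArc : ∀ {D k} {f : Fin (n D) → Fin (suc (suc k))} (u v : Fin (n D)) →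
  IsSIDP D (suc (suc k)) f → Strong (D -arc (u , v)) → HasSIDP (D -arc (u , v)) (suc k)
IsSIDP⇒HasSIDP-deleteArc {D} {f = f} u v (surj , sid) strongE =
  merge (bypassClass (Walk-lastExit (Class f p) (strongE u v ∈⊤ ∈⊤)))
  where
  open DeleteArc D u v
  p = f v
  sidE : ∀ j → j ≢ p → StrongInDominating E (Class f j)
  sidE j j≢p = StrongInDominating-deleteArc⁺ (λ v∈ → j≢p (sym (∈-Class⁻ f v∈))) (sid j)
  bypassClass : Walk E (Class f p) u v ⊎ ∃ (λ x → x ∉ Class f p × Walk E (Class f p) x v) →
    ∃ λ q → p ≢ q × Walk E (Class f p ∪ Class f q) u v
  bypassClass (inj₁ u⇝v) =
    punchIn p fzero , punchInᵢ≢i p fzero ∘ sym , Walk-mono (p⊆p∪q _) u⇝v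
  bypassClass (inj₂ (x , x∉ , x⇝v)) =
    f x , x∉ ∘ ∈-Class⁺ f ∘ sym ,
    Walk-into (sidE (f x) (x∉ ∘ ∈-Class⁺ f)) (q⊆p∪q _ _) (∈-Class⁺ f refl) u
      ++ʷ Walk-mono (p⊆p∪q _) x⇝v
  merge : (∃ λ q → p ≢ q × Walk E (Class f p ∪ Class f q) u v) → HasSIDP E _
  merge (q , p≢q , u⇝v) =
    mergeClasses p≢q surj sidE (StrongOn-deleteArc (λ _ _ → u⇝v) (StrongOn-∪ (sid p) (sid q)))

IsStrongInDomNum-unique : ∀ {D m m′} → IsStrongInDomNum D m → IsStrongInDomNum D m′ → m ≡ m′
IsStrongInDomNum-unique (has , max) (has′ , max′) = ≤-antisym (max′ _ has) (max _ has′)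

critical⇒¬HasSIDP-deleteArc : ∀ {D m u v} → IsStrongInDomNum D m → StrongInDomCritical D →
  Arc D u v → ¬ HasSIDP (D -arc (u , v)) m
critical⇒¬HasSIDP-deleteArc {D} {m} {u} {v} num crit u⇒v (f , sidp) with crit u v u⇒v
... | _ , m′ , numD , numE =
  m≰m∸1 (f u) (subst (λ k → m ≤ k ∸ 1) (IsStrongInDomNum-unique numD num) (proj₂ numE m (f , sidp)))
  where
  m≰m∸1 : ∀ {k} → Fin k → ¬ k ≤ k ∸ 1
  m≰m∸1 {suc k} _ = 1+n≰n

critical⇒conditionB : ∀ {D m} → IsStrongInDomNum D m → StrongInDomCritical D → ConditionB D m
critical⇒conditionB {D} {m} num crit f sidp = arcsCritical , uniqueOutNbr
  where
  survives : ∀ {u v} → Arc D u v → ¬ IsSIDP (D -arc (u , v)) m f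
  survives u⇒v sidpE = critical⇒¬HasSIDP-deleteArc num crit u⇒v (f , sidpE)

  arcsCritical : ∀ i u v → u ∈ Class f i → v ∈ Class f i → Arc D u v →
    ¬ StrongOn (D -arc (u , v)) (Class f i)
  arcsCritical i u v u∈ v∈ u⇒v strongE with ∈-Class⁻ f v∈
  ... | refl = survives u⇒v (IsSIDP-deleteArc⁺ sidp (λ _ → strongE) (contradiction (∈-Class⁻ f u∈)))
    where open DeleteArc D u v

  uniqueOutNbr : ∀ i u → u ∉ Class f i → ∣ Class f i ∩ OutNbr D u ∣ ≡ 1
  uniqueOutNbr i u u∉ with proj₁ (proj₂ sidp i) u u∉
  ... | x , x∈ , u⇒x = ∣p∣≡1⁺ (x∈p∩q⁺ (x∈ , ∈-OutNbr⁺ D u⇒x)) onlyX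
    where
    onlyX : ∀ {y} → y ∈ Class f i ∩ OutNbr D u → y ≡ x
    onlyX {y} y∈ with y ≟ x | x∈p∩q⁻ (Class f i) (OutNbr D u) y∈
    ... | yes y≡x | _ = y≡x
    ... | no y≢x | y∈i , y∈N = contradiction (IsSIDP-deleteArc⁺ sidp sameClass otherClass) (survives u⇒y)
      where
      open DeleteArc D u y
      u⇒y = ∈-OutNbr⁻ D y∈N
      sameClass : f u ≡ f y → StrongOn E (Class f (f y))
      sameClass fu≡fy = contradiction (∈-Class⁺ f (trans fu≡fy (∈-Class⁻ f y∈i))) u∉
      otherClass : f u ≢ f y → ∃ λ w → w ∈ Class f (f y) × Arc E u w
      otherClass _ = x , ∈-Class⁺ f (trans (∈-Class⁻ f x∈) (sym (∈-Class⁻ f y∈i))) ,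
                     arc⁺ u⇒x (λ (_ , x≡y) → y≢x (sym x≡y))

conditionB⇒¬IsSIDP-deleteArc : ∀ {D m} {g : Fin (n D) → Fin m} → ConditionB D m →
  ∀ {u v} → Arc D u v → ¬ IsSIDP (D -arc (u , v)) m g
conditionB⇒¬IsSIDP-deleteArc {D} {g = g} condB {u} {v} u⇒v sidpE with g u ≟ g v
... | yes gu≡gv = proj₁ (condB g sidp) (g v) u v (∈-Class⁺ g gu≡gv) (∈-Class⁺ g refl) u⇒v
                    (proj₂ (proj₂ sidpE (g v)))
  where open DeleteArc D u v
        sidp = IsSIDP-deleteArc⁻ sidpE
... | no gu≢gv with proj₁ (proj₂ sidpE (g v)) u (gu≢gv ∘ ∈-Class⁻ g)
...   | w , w∈ , u⇒w = ¬arc-deleted (subst (Arc E u) w≡v u⇒w)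
  where
  open DeleteArc D u v
  w≡v : w ≡ v
  w≡v = ∣p∣≡1⁻ (proj₂ (condB g (IsSIDP-deleteArc⁻ sidpE)) (g v) u (gu≢gv ∘ ∈-Class⁻ g))
          (x∈p∩q⁺ (w∈ , ∈-OutNbr⁺ D (arc⁻ u⇒w))) (x∈p∩q⁺ (∈-Class⁺ g refl , ∈-OutNbr⁺ D u⇒v))

conditionB⇒critical : ∀ {D k} → IsStrongInDomNum D (suc (suc k)) →
  (∀ u v → Arc D u v → Strong (D -arc (u , v))) → ConditionB D (suc (suc k)) →
  StrongInDomCritical D
conditionB⇒critical {D} {k} num@((f , sidp) , max) strongE condB u v u⇒v =
  strongE u v u⇒v , suc (suc k) , num , lower , upper
  where
  open DeleteArc D u v
  lower : HasSIDP E (suc k)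
  lower = IsSIDP⇒HasSIDP-deleteArc u v sidp (strongE u v u⇒v)
  upper : ∀ k′ → HasSIDP E k′ → k′ ≤ suc k
  upper k′ (g , sidpE) with k′ ≟ℕ suc (suc k)
  ... | yes refl = contradiction sidpE (conditionB⇒¬IsSIDP-deleteArc condB u⇒v)
  ... | no k′≢   = ≤-pred (≤∧≢⇒< (max k′ (g , IsSIDP-deleteArc⁻ sidpE)) k′≢)

theorem4 : (D : Digraph) (m : ℕ) → IsStrongInDomNum D m → 2 ≤ m →
    (∀ u v → Arc D u v → Strong (D -arc (u , v))) →
    (StrongInDomCritical D ⇔ ConditionB D m)
theorem4 D (suc (suc k)) num (s≤s (s≤s z≤n)) strongE =
  mk⇔ (critical⇒conditionB num) (conditionB⇒critical num strongE)
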